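{- There are infinitely many irreducible cubic polynomials $f\in \mathbb{Z}[x]$ with emergent reducibility at depth $1$ (over $\mathbb{Q}$); that is, there are infinitely many cubics $f \in \mathbb{Z}[x]$ such that $f$ is irreducible over $\mathbb{Q}$ but $f\circ f$ is reducible over $\mathbb{Q}$.
   Context: For a field $K$ and $f\in K[x]$, write $f^{\circ 0}=f$ and $f^{\circ k}=f\circ f^{\circ (k-1)}$, so $f^{\circ k}$ is $f$ composed with itself $k$ additional times ($f^{\circ 1}=f\circ f$). The polynomial $f$ has emergent reducibility at depth $n$ over $K$ if $f^{\circ i}$ is irreducible over $K$ for $0\le i\le n-1$ and $f^{\circ n}$ is reducible over $K$. Here $K=\mathbb{Q}$. -}

module Defs where

open import Data.Nat using (ℕ; zero; suc; _≤_)
open import Data.Integer using (ℤ)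
open import Data.Rational using (ℚ; 0ℚ; _/_; _+_; _*_)
open import Data.List using (List; []; _∷_; map)
open import Data.Product using (Σ; _×_; _,_)
open import Data.Sum using (_⊎_)
open import Relation.Binary.PropositionalEquality using (_≡_; _≢_)
open import Relation.Nullary using (¬_)

-- Polynomials over ℚ: coefficient lists, lowest degree first.
-- Trailing zeros are allowed; equality is coefficientwise (see _≈ₚ_).
Polyℚ : Set
Polyℚ = List ℚ

coeff : Polyℚ → ℕ → ℚ
coeff []       _       = 0ℚ
coeff (a ∷ p)  zero    = a
coeff (a ∷ p)  (suc n) = coeff p n

_≈ₚ_ : Polyℚ → Polyℚ → Set
p ≈ₚ q = ∀ n → coeff p n ≡ coeff q n

_⊕_ : Polyℚ → Polyℚ → Polyℚ
[]      ⊕ q       = q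
(a ∷ p) ⊕ []      = a ∷ p
(a ∷ p) ⊕ (b ∷ q) = (a + b) ∷ (p ⊕ q)

_·_ : ℚ → Polyℚ → Polyℚ
c · p = map (c *_) p

_⊗_ : Polyℚ → Polyℚ → Polyℚ
[]      ⊗ q = []
(a ∷ p) ⊗ q = (a · q) ⊕ (0ℚ ∷ (p ⊗ q))

_∘ₚ_ : Polyℚ → Polyℚ → Polyℚ
[]      ∘ₚ g = []
(a ∷ p) ∘ₚ g = (a ∷ []) ⊕ (g ⊗ (p ∘ₚ g))

PositiveDegree : Polyℚ → Set
PositiveDegree p = Σ ℕ λ k → (1 ≤ k) × (coeff p k ≢ 0ℚ)

IsUnit : Polyℚ → Set
IsUnit p = Σ ℚ λ c → (c ≢ 0ℚ) × (p ≈ₚ (c ∷ []))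

Irreducible : Polyℚ → Set
Irreducible f = PositiveDegree f × (∀ g h → f ≈ₚ (g ⊗ h) → IsUnit g ⊎ IsUnit h)

Reducible : Polyℚ → Set
Reducible f = ¬ Irreducible f

ℤ→ℚ : ℤ → ℚ
ℤ→ℚ z = z / 1

-- the cubic a x^3 + b x^2 + c x + d ∈ ℤ[x], viewed in ℚ[x];
-- coefficient tuple given as (a , b , c , d)
Coeffs4 : Set
Coeffs4 = ℤ × ℤ × ℤ × ℤ

cubic : Coeffs4 → Polyℚ
cubic (a , b , c , d) = ℤ→ℚ d ∷ ℤ→ℚ c ∷ ℤ→ℚ b ∷ ℤ→ℚ a ∷ []

leading : Coeffs4 → ℤ
leading (a , _ , _ , _) = a

-- For k ∈ ℕ take f = (1 + 3k)(6x + 1)³ − x²(2x + 1)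
--                  = (214 + 648k)x³ + (107 + 324k)x² + (18 + 54k)x + (1 + 3k).
-- Modulo 3, f ≡ x³ + 2x² + 1, and the form P³ + 2P²Q + Q³ is divisible by 3 only when
-- both P and Q are; clearing denominators, f has no rational root, so the cubic f is irreducible.
-- For g = −(2x + 1)/4 one checks f(g) = −(f − g)/8. Since f(y) − f(z) = (y − z)·q(y, z) with q
-- the divided difference of f, putting y = f and z = g gives f∘f = (q(f, g) − 1/8)·(f − g),
-- a product of factors of degrees 6 and 3.
module Submission where

open import Defs
open import Data.Integer using (ℤ; 0ℤ)
open import Data.List using (List)
open import Data.List.Membership.Propositional using (_∉_)
open import Data.Product using (Σ; _×_)
open import Relation.Binary.PropositionalEquality using (_≢_)

open import Algebra.Bundles using (CommutativeRing; CommutativeMonoid)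
open import Algebra.Solver.Ring.AlmostCommutativeRing using (_-Raw-AlmostCommutative⟶_; fromCommutativeRing)
import Algebra.Solver.Ring
open import Data.Empty using (⊥-elim)
open import Data.Integer as ℤ using (+_; -[1+_])
open import Data.Integer.Base using (_%ℕ_; _/ℕ_)
open import Data.Integer.DivMod using (a≡a%ℕn+[a/ℕn]*n; n%ℕd<d)
open import Data.Integer.Divisibility.Signed
  using (_∣_; divides; _∣?_; ∣⇒∣ᵤ; ∣m∣n⇒∣m+n; ∣m∣n⇒∣m-n; ∣n⇒∣m*n; ∣m⇒∣m*n)
import Data.Integer.Properties as ℤP
open import Data.Integer.Tactic.RingSolver using (solve-∀)
open import Data.Nat.Tactic.RingSolver using () renaming (solve-∀ to ℕ-solve-∀)
open import Data.List using ([]; _∷_; map)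
open import Data.List.Membership.Propositional using (_∈_)
open import Data.List.Relation.Unary.Any using (here; there)
import Data.Maybe as Maybe
open import Data.Nat as ℕ using (ℕ; zero; suc; s≤s; z≤n)
open import Data.Nat.Coprimality using (recompute)
import Data.Nat.Properties as ℕP
open import Data.Product using (_,_; proj₁; proj₂)
open import Data.Rational as ℚ using (ℚ; mkℚ; 0ℚ; 1ℚ; _+_; _*_; -_; 1/_; toℚᵘ)
import Data.Rational.Properties as ℚP
import Data.Rational.Solver
open import Data.Rational.Unnormalised as ℚᵘ using (mkℚᵘ; *≡*) renaming (_≃_ to _≃ᵘ_)
import Data.Rational.Unnormalised.Properties as ℚᵘP
open import Data.Sum using (_⊎_; inj₁; inj₂)
open import Relation.Binary.Bundles using (Setoid)
open import Relation.Binary.Definitions using (tri<; tri≈; tri>)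
open import Relation.Binary.PropositionalEquality
import Relation.Binary.Reasoning.Setoid as SetoidReasoning
open import Relation.Nullary using (yes; no)
open import Relation.Nullary.Decidable using (from-no; dec⇒maybe)
open import Algebra.Properties.CommutativeSemigroup
  (CommutativeMonoid.commutativeSemigroup ℚP.+-0-commutativeMonoid) using (interchange)

module ℚ-Solver = Data.Rational.Solver.+-*-Solver

-- ℚ[x] as a commutative ring

-- Equality of polynomials wrapped in a record, so that the polynomials can be inferred from a proof.
infix 4 _≋_
record _≋_ (p q : Polyℚ) : Set where
  field coeff-≡ : p ≈ₚ q
open _≋_ public

≋-setoid : Setoid _ _
≋-setoid = record
  { Carrier       = Polyℚ
  ; _≈_           = _≋_
  ; isEquivalence = record
    { refl  = λ where .coeff-≡ _ → refl
    ; sym   = λ where p≋q .coeff-≡ n → sym (p≋q .coeff-≡ n)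
    ; trans = λ where p≋q q≋r .coeff-≡ n → trans (p≋q .coeff-≡ n) (q≋r .coeff-≡ n)
    }
  }

open Setoid ≋-setoid public using () renaming (refl to ≋-refl; sym to ≋-sym; trans to ≋-trans)
module ≋-Reasoning = SetoidReasoning ≋-setoid

const : ℚ → Polyℚ
const a = a ∷ []

X : Polyℚ
X = 0ℚ ∷ 1ℚ ∷ []

shift : Polyℚ → Polyℚ
shift p = 0ℚ ∷ p

⊝_ : Polyℚ → Polyℚ
⊝_ = map -_

_⊖_ : Polyℚ → Polyℚ → Polyℚ
p ⊖ q = p ⊕ (⊝ q)

coeff-⊕ : ∀ p q n → coeff (p ⊕ q) n ≡ coeff p n + coeff q n
coeff-⊕ []      q       n       = sym (ℚP.+-identityˡ (coeff q n))
coeff-⊕ (a ∷ p) []      n       = sym (ℚP.+-identityʳ (coeff (a ∷ p) n))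
coeff-⊕ (a ∷ p) (b ∷ q) zero    = refl
coeff-⊕ (a ∷ p) (b ∷ q) (suc n) = coeff-⊕ p q n

coeff-· : ∀ c p n → coeff (c · p) n ≡ c * coeff p n
coeff-· c []      n       = sym (ℚP.*-zeroʳ c)
coeff-· c (a ∷ p) zero    = refl
coeff-· c (a ∷ p) (suc n) = coeff-· c p n

coeff-⊝ : ∀ p n → coeff (⊝ p) n ≡ - coeff p n
coeff-⊝ []      n       = refl
coeff-⊝ (a ∷ p) zero    = refl
coeff-⊝ (a ∷ p) (suc n) = coeff-⊝ p n

∷-cong : ∀ {a b p q} → a ≡ b → p ≋ q → (a ∷ p) ≋ (b ∷ q)
∷-cong a≡b p≋q .coeff-≡ zero    = a≡b
∷-cong a≡b p≋q .coeff-≡ (suc n) = p≋q .coeff-≡ n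

tail-≋ : ∀ {a b p q} → (a ∷ p) ≋ (b ∷ q) → p ≋ q
tail-≋ e .coeff-≡ n = e .coeff-≡ (suc n)

tail-≋[] : ∀ {a p} → (a ∷ p) ≋ [] → p ≋ []
tail-≋[] e .coeff-≡ n = e .coeff-≡ (suc n)

shift-cong : ∀ {p q} → p ≋ q → shift p ≋ shift q
shift-cong = ∷-cong refl

shift-[] : shift [] ≋ []
shift-[] .coeff-≡ zero    = refl
shift-[] .coeff-≡ (suc n) = refl

⊕-cong : ∀ {p p′ q q′} → p ≋ p′ → q ≋ q′ → (p ⊕ q) ≋ (p′ ⊕ q′)
⊕-cong {p} {p′} {q} {q′} p≋p′ q≋q′ .coeff-≡ n = begin
  coeff (p ⊕ q) n         ≡⟨ coeff-⊕ p q n ⟩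
  coeff p n + coeff q n   ≡⟨ cong₂ _+_ (p≋p′ .coeff-≡ n) (q≋q′ .coeff-≡ n) ⟩
  coeff p′ n + coeff q′ n ≡⟨ coeff-⊕ p′ q′ n ⟨
  coeff (p′ ⊕ q′) n       ∎
  where open ≡-Reasoning

⊕-assoc : ∀ p q r → ((p ⊕ q) ⊕ r) ≋ (p ⊕ (q ⊕ r))
⊕-assoc p q r .coeff-≡ n
  rewrite coeff-⊕ (p ⊕ q) r n | coeff-⊕ p q n | coeff-⊕ p (q ⊕ r) n | coeff-⊕ q r n =
  ℚP.+-assoc (coeff p n) (coeff q n) (coeff r n)

⊕-comm : ∀ p q → (p ⊕ q) ≋ (q ⊕ p)
⊕-comm p q .coeff-≡ n rewrite coeff-⊕ p q n | coeff-⊕ q p n = ℚP.+-comm (coeff p n) (coeff q n)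

⊕-identityʳ : ∀ p → (p ⊕ []) ≋ p
⊕-identityʳ p .coeff-≡ n rewrite coeff-⊕ p [] n = ℚP.+-identityʳ (coeff p n)

⊕-inverseˡ : ∀ p → ((⊝ p) ⊕ p) ≋ []
⊕-inverseˡ p .coeff-≡ n rewrite coeff-⊕ (⊝ p) p n | coeff-⊝ p n = ℚP.+-inverseˡ (coeff p n)

⊝-cong : ∀ {p q} → p ≋ q → (⊝ p) ≋ (⊝ q)
⊝-cong {p} {q} p≋q .coeff-≡ n rewrite coeff-⊝ p n | coeff-⊝ q n = cong -_ (p≋q .coeff-≡ n)

⊕-interchange : ∀ p q r s → ((p ⊕ q) ⊕ (r ⊕ s)) ≋ ((p ⊕ r) ⊕ (q ⊕ s))
⊕-interchange p q r s .coeff-≡ n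
  rewrite coeff-⊕ (p ⊕ q) (r ⊕ s) n | coeff-⊕ p q n | coeff-⊕ r s n
        | coeff-⊕ (p ⊕ r) (q ⊕ s) n | coeff-⊕ p r n | coeff-⊕ q s n =
  interchange (coeff p n) (coeff q n) (coeff r n) (coeff s n)

·-cong : ∀ c {p q} → p ≋ q → (c · p) ≋ (c · q)
·-cong c {p} {q} p≋q .coeff-≡ n rewrite coeff-· c p n | coeff-· c q n = cong (c *_) (p≋q .coeff-≡ n)

·-distribˡ : ∀ c p q → (c · (p ⊕ q)) ≋ ((c · p) ⊕ (c · q))
·-distribˡ c p q .coeff-≡ n
  rewrite coeff-· c (p ⊕ q) n | coeff-⊕ p q n | coeff-⊕ (c · p) (c · q) n | coeff-· c p n | coeff-· c q n =
  ℚP.*-distribˡ-+ c (coeff p n) (coeff q n)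

·-assoc : ∀ c d p → ((c * d) · p) ≋ (c · (d · p))
·-assoc c d p .coeff-≡ n rewrite coeff-· (c * d) p n | coeff-· c (d · p) n | coeff-· d p n =
  ℚP.*-assoc c d (coeff p n)

·-zeroˡ : ∀ p → (0ℚ · p) ≋ []
·-zeroˡ p .coeff-≡ n rewrite coeff-· 0ℚ p n = ℚP.*-zeroˡ (coeff p n)

·-identityˡ : ∀ p → (1ℚ · p) ≋ p
·-identityˡ p .coeff-≡ n rewrite coeff-· 1ℚ p n = ℚP.*-identityˡ (coeff p n)

·-shift : ∀ c p → (c · shift p) ≋ shift (c · p)
·-shift c p = ∷-cong (ℚP.*-zeroʳ c) (≋-refl {c · p})

⊗-congʳ : ∀ p {q q′} → q ≋ q′ → (p ⊗ q) ≋ (p ⊗ q′)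
⊗-congʳ []      q≋q′ = ≋-refl
⊗-congʳ (a ∷ p) q≋q′ = ⊕-cong (·-cong a q≋q′) (shift-cong (⊗-congʳ p q≋q′))

⊗-zeroʳ : ∀ p → (p ⊗ []) ≋ []
⊗-zeroʳ []      = ≋-refl
⊗-zeroʳ (a ∷ p) = ≋-trans (shift-cong (⊗-zeroʳ p)) shift-[]

⊗-zeroˡ : ∀ p q → p ≋ [] → (p ⊗ q) ≋ []
⊗-zeroˡ []      q p≋0 = ≋-refl
⊗-zeroˡ (a ∷ p) q p≋0 with p≋0 .coeff-≡ zero
... | refl = ≋-trans (⊕-cong (·-zeroˡ q) (shift-cong (⊗-zeroˡ p q (tail-≋[] p≋0)))) shift-[]

⊗-congˡ : ∀ {p p′} q → p ≋ p′ → (p ⊗ q) ≋ (p′ ⊗ q)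
⊗-congˡ {[]}    {p′}     q p≋p′ = ≋-sym (⊗-zeroˡ p′ q (≋-sym p≋p′))
⊗-congˡ {a ∷ p} {[]}     q p≋p′ = ⊗-zeroˡ (a ∷ p) q p≋p′
⊗-congˡ {a ∷ p} {b ∷ p′} q p≋p′ with p≋p′ .coeff-≡ zero
... | refl = ⊕-cong ≋-refl (shift-cong (⊗-congˡ q (tail-≋ p≋p′)))

⊗-cong : ∀ {p p′ q q′} → p ≋ p′ → q ≋ q′ → (p ⊗ q) ≋ (p′ ⊗ q′)
⊗-cong {p′ = p′} {q} p≋p′ q≋q′ = ≋-trans (⊗-congˡ q p≋p′) (⊗-congʳ p′ q≋q′)

⊗-distribˡ : ∀ p q r → (p ⊗ (q ⊕ r)) ≋ ((p ⊗ q) ⊕ (p ⊗ r))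
⊗-distribˡ []      q r = ≋-refl
⊗-distribˡ (a ∷ p) q r = begin
  (a · (q ⊕ r)) ⊕ shift (p ⊗ (q ⊕ r))
    ≈⟨ ⊕-cong (·-distribˡ a q r) (shift-cong (⊗-distribˡ p q r)) ⟩
  ((a · q) ⊕ (a · r)) ⊕ shift ((p ⊗ q) ⊕ (p ⊗ r))
    ≈⟨ ⊕-cong ≋-refl (∷-cong (ℚP.+-identityʳ 0ℚ) ≋-refl) ⟩
  ((a · q) ⊕ (a · r)) ⊕ (shift (p ⊗ q) ⊕ shift (p ⊗ r))
    ≈⟨ ⊕-interchange (a · q) (a · r) (shift (p ⊗ q)) (shift (p ⊗ r)) ⟩
  ((a · q) ⊕ shift (p ⊗ q)) ⊕ ((a · r) ⊕ shift (p ⊗ r))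
    ∎
  where open ≋-Reasoning

⊗-constʳ : ∀ p a → (p ⊗ const a) ≋ (a · p)
⊗-constʳ []      a = ≋-refl
⊗-constʳ (b ∷ p) a = ∷-cong (trans (ℚP.+-identityʳ (b * a)) (ℚP.*-comm b a)) (⊗-constʳ p a)

⊗-shiftʳ : ∀ p q → (p ⊗ shift q) ≋ shift (p ⊗ q)
⊗-shiftʳ []      q = ≋-sym shift-[]
⊗-shiftʳ (a ∷ p) q = ∷-cong (trans (ℚP.+-identityʳ (a * 0ℚ)) (ℚP.*-zeroʳ a)) (⊕-cong ≋-refl (⊗-shiftʳ p q))

⊗-shiftˡ : ∀ p q → (shift p ⊗ q) ≋ shift (p ⊗ q)
⊗-shiftˡ p q = ⊕-cong (·-zeroˡ q) ≋-refl

⊗-·ˡ : ∀ c p q → ((c · p) ⊗ q) ≋ (c · (p ⊗ q))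
⊗-·ˡ c []      q = ≋-refl
⊗-·ˡ c (a ∷ p) q = begin
  ((c * a) · q) ⊕ shift ((c · p) ⊗ q)  ≈⟨ ⊕-cong (·-assoc c a q) (shift-cong (⊗-·ˡ c p q)) ⟩
  (c · (a · q)) ⊕ shift (c · (p ⊗ q))  ≈⟨ ⊕-cong ≋-refl (≋-sym (·-shift c (p ⊗ q))) ⟩
  (c · (a · q)) ⊕ (c · shift (p ⊗ q))  ≈⟨ ≋-sym (·-distribˡ c (a · q) (shift (p ⊗ q))) ⟩
  c · ((a · q) ⊕ shift (p ⊗ q))        ∎
  where open ≋-Reasoning

⊗-comm : ∀ p q → (p ⊗ q) ≋ (q ⊗ p)
⊗-comm []      q = ≋-sym (⊗-zeroʳ q)
⊗-comm (a ∷ p) q = begin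
  (a · q) ⊕ shift (p ⊗ q)        ≈⟨ ⊕-cong (≋-sym (⊗-constʳ q a)) (shift-cong (⊗-comm p q)) ⟩
  (q ⊗ const a) ⊕ shift (q ⊗ p)  ≈⟨ ⊕-cong ≋-refl (≋-sym (⊗-shiftʳ q p)) ⟩
  (q ⊗ const a) ⊕ (q ⊗ shift p)  ≈⟨ ≋-sym (⊗-distribˡ q (const a) (shift p)) ⟩
  q ⊗ (const a ⊕ shift p)        ≈⟨ ⊗-congʳ q (∷-cong (ℚP.+-identityʳ a) ≋-refl) ⟩
  q ⊗ (a ∷ p)                    ∎
  where open ≋-Reasoning

⊗-distribʳ : ∀ p q r → ((q ⊕ r) ⊗ p) ≋ ((q ⊗ p) ⊕ (r ⊗ p))
⊗-distribʳ p q r = begin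
  (q ⊕ r) ⊗ p        ≈⟨ ⊗-comm (q ⊕ r) p ⟩
  p ⊗ (q ⊕ r)        ≈⟨ ⊗-distribˡ p q r ⟩
  (p ⊗ q) ⊕ (p ⊗ r)  ≈⟨ ⊕-cong (⊗-comm p q) (⊗-comm p r) ⟩
  (q ⊗ p) ⊕ (r ⊗ p)  ∎
  where open ≋-Reasoning

⊗-assoc : ∀ p q r → ((p ⊗ q) ⊗ r) ≋ (p ⊗ (q ⊗ r))
⊗-assoc []      q r = ≋-refl
⊗-assoc (a ∷ p) q r = begin
  ((a · q) ⊕ shift (p ⊗ q)) ⊗ r        ≈⟨ ⊗-distribʳ r (a · q) (shift (p ⊗ q)) ⟩
  ((a · q) ⊗ r) ⊕ (shift (p ⊗ q) ⊗ r)  ≈⟨ ⊕-cong (⊗-·ˡ a q r) (⊗-shiftˡ (p ⊗ q) r) ⟩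
  (a · (q ⊗ r)) ⊕ shift ((p ⊗ q) ⊗ r)  ≈⟨ ⊕-cong ≋-refl (shift-cong (⊗-assoc p q r)) ⟩
  (a · (q ⊗ r)) ⊕ shift (p ⊗ (q ⊗ r))  ∎
  where open ≋-Reasoning

⊗-identityˡ : ∀ p → (const 1ℚ ⊗ p) ≋ p
⊗-identityˡ p = ≋-trans (⊕-cong (·-identityˡ p) shift-[]) (⊕-identityʳ p)

ℚ[x]-commutativeRing : CommutativeRing _ _
ℚ[x]-commutativeRing = record
  { Carrier           = Polyℚ
  ; _≈_               = _≋_
  ; _+_               = _⊕_
  ; _*_               = _⊗_
  ; -_                = ⊝_
  ; 0#                = []
  ; 1#                = const 1ℚ
  ; isCommutativeRing = record
    { isRing = record
      { +-isAbelianGroup = record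
        { isGroup = record
          { isMonoid = record
            { isSemigroup = record
              { isMagma = record { isEquivalence = Setoid.isEquivalence ≋-setoid ; ∙-cong = ⊕-cong }
              ; assoc   = ⊕-assoc
              }
            ; identity = (λ _ → ≋-refl) , ⊕-identityʳ
            }
          ; inverse = ⊕-inverseˡ , λ p → ≋-trans (⊕-comm p (⊝ p)) (⊕-inverseˡ p)
          ; ⁻¹-cong = ⊝-cong
          }
        ; comm = ⊕-comm
        }
      ; *-cong     = ⊗-cong
      ; *-assoc    = ⊗-assoc
      ; *-identity = ⊗-identityˡ , λ p → ≋-trans (⊗-comm p (const 1ℚ)) (⊗-identityˡ p)
      ; distrib    = ⊗-distribˡ , ⊗-distribʳ
      }
    ; *-comm = ⊗-comm
    }
  }

const-homomorphism : ℚP.+-*-rawRing -Raw-AlmostCommutative⟶ fromCommutativeRing ℚ[x]-commutativeRing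
const-homomorphism = record
  { ⟦_⟧    = const
  ; +-homo = λ _ _ → ≋-refl
  ; *-homo = λ a b → ∷-cong (sym (ℚP.+-identityʳ (a * b))) ≋-refl
  ; -‿homo = λ _ → ≋-refl
  ; 0-homo = shift-[]
  ; 1-homo = ≋-refl
  }

const-≋? : ∀ a b → Maybe.Maybe (const a ≋ const b)
const-≋? a b = Maybe.map (λ { refl → ≋-refl }) (dec⇒maybe (a ℚP.≟ b))

module ℚ[x]-Solver = Algebra.Solver.Ring ℚP.+-*-rawRing (fromCommutativeRing ℚ[x]-commutativeRing)
  const-homomorphism const-≋?

-- Composition with a cubic

horner₃ : Polyℚ → Polyℚ → Polyℚ → Polyℚ → Polyℚ → Polyℚ
horner₃ A B C D r = D ⊕ (r ⊗ (C ⊕ (r ⊗ (B ⊕ (r ⊗ A)))))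

horner₃-cong : ∀ {A A′ B B′ C C′ D D′} r → A ≋ A′ → B ≋ B′ → C ≋ C′ → D ≋ D′ →
               horner₃ A B C D r ≋ horner₃ A′ B′ C′ D′ r
horner₃-cong r A≋A′ B≋B′ C≋C′ D≋D′ =
  ⊕-cong D≋D′ (⊗-congʳ r (⊕-cong C≋C′ (⊗-congʳ r (⊕-cong B≋B′ (⊗-congʳ r A≋A′)))))

∘ₚ-cubic : ∀ a b c d r → ((d ∷ c ∷ b ∷ a ∷ []) ∘ₚ r) ≋ horner₃ (const a) (const b) (const c) (const d) r
∘ₚ-cubic a b c d r =
  horner₃-cong r (≋-trans (⊕-cong ≋-refl (⊗-zeroʳ r)) (⊕-identityʳ (const a))) ≋-refl ≋-refl ≋-refl

X⊗ : ∀ p → (X ⊗ p) ≋ shift p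
X⊗ p = ≋-trans (⊕-cong (·-zeroˡ p) (shift-cong (⊗-identityˡ p))) (⊕-identityʳ (shift p))

∘ₚ-X : ∀ p → (p ∘ₚ X) ≋ p
∘ₚ-X []      = ≋-refl
∘ₚ-X (a ∷ p) = ≋-trans (⊕-cong (≋-refl {const a}) (≋-trans (⊗-congʳ X (∘ₚ-X p)) (X⊗ p)))
                       (∷-cong (ℚP.+-identityʳ a) ≋-refl)

differenceQuotient : Polyℚ → Polyℚ → Polyℚ → Polyℚ → Polyℚ → Polyℚ
differenceQuotient A B C p q = (A ⊗ ((p ⊗ p) ⊕ ((p ⊗ q) ⊕ (q ⊗ q)))) ⊕ ((B ⊗ (p ⊕ q)) ⊕ C)

horner₃-difference : ∀ A B C D p q →
  horner₃ A B C D p ≋ (horner₃ A B C D q ⊕ ((p ⊖ q) ⊗ differenceQuotient A B C p q))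
horner₃-difference = solve 6 (λ A B C D p q →
  D :+ p :* (C :+ p :* (B :+ p :* A))
    := D :+ q :* (C :+ q :* (B :+ q :* A))
       :+ (p :- q) :* (A :* (p :* p :+ (p :* q :+ q :* q)) :+ (B :* (p :+ q) :+ C))) ≋-refl
  where open ℚ[x]-Solver

∘ₚ-self-factorisation : ∀ a b c d g l → let f = d ∷ c ∷ b ∷ a ∷ [] in
  (f ∘ₚ g) ≋ (const l ⊗ (f ⊖ g)) →
  (f ∘ₚ f) ≋ ((differenceQuotient (const a) (const b) (const c) f g ⊕ const l) ⊗ (f ⊖ g))
∘ₚ-self-factorisation a b c d g l f∘g≋ = begin
  f ∘ₚ f                               ≈⟨ ∘ₚ-cubic a b c d f ⟩
  horner₃ A B C D f                    ≈⟨ horner₃-difference A B C D f g ⟩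
  horner₃ A B C D g ⊕ ((f ⊖ g) ⊗ Q)    ≈⟨ ⊕-cong (≋-sym (∘ₚ-cubic a b c d g)) (≋-refl {(f ⊖ g) ⊗ Q}) ⟩
  (f ∘ₚ g) ⊕ ((f ⊖ g) ⊗ Q)             ≈⟨ ⊕-cong f∘g≋ (≋-refl {(f ⊖ g) ⊗ Q}) ⟩
  (const l ⊗ (f ⊖ g)) ⊕ ((f ⊖ g) ⊗ Q)  ≈⟨ solve 3 (λ L H Q → L :* H :+ H :* Q := (Q :+ L) :* H) ≋-refl
                                                (const l) (f ⊖ g) Q ⟩
  (Q ⊕ const l) ⊗ (f ⊖ g)              ∎
  where
  open ≋-Reasoning
  open ℚ[x]-Solver
  f = d ∷ c ∷ b ∷ a ∷ []
  A = const a
  B = const b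
  C = const c
  D = const d
  Q = differenceQuotient A B C f g

-- Degrees

record DegreeAtMost (p : Polyℚ) (d : ℕ) : Set where
  field vanishes : ∀ k → d ℕ.< k → coeff p k ≡ 0ℚ
open DegreeAtMost public

record HasDegree (p : Polyℚ) (d : ℕ) : Set where
  constructor _,_
  field
    lead≢0       : coeff p d ≢ 0ℚ
    degreeAtMost : DegreeAtMost p d

degreeAtMost-≋ : ∀ {p q d} → p ≋ q → DegreeAtMost q d → DegreeAtMost p d
degreeAtMost-≋ p≋q q≤d .vanishes k d<k = trans (p≋q .coeff-≡ k) (q≤d .vanishes k d<k)

degreeAtMost-mono : ∀ {p d e} → d ℕ.≤ e → DegreeAtMost p d → DegreeAtMost p e
degreeAtMost-mono d≤e p≤d .vanishes k e<k = p≤d .vanishes k (ℕP.≤-<-trans d≤e e<k)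

degreeAtMost-⊕ : ∀ {p q d} → DegreeAtMost p d → DegreeAtMost q d → DegreeAtMost (p ⊕ q) d
degreeAtMost-⊕ {p} {q} p≤d q≤d .vanishes k d<k =
  trans (coeff-⊕ p q k) (trans (cong₂ _+_ (p≤d .vanishes k d<k) (q≤d .vanishes k d<k)) (ℚP.+-identityʳ 0ℚ))

degreeAtMost-· : ∀ c {p d} → DegreeAtMost p d → DegreeAtMost (c · p) d
degreeAtMost-· c {p} p≤d .vanishes k d<k =
  trans (coeff-· c p k) (trans (cong (c *_) (p≤d .vanishes k d<k)) (ℚP.*-zeroʳ c))

degreeAtMost-shift : ∀ {p d} → DegreeAtMost p d → DegreeAtMost (shift p) (suc d)
degreeAtMost-shift p≤d .vanishes (suc k) (s≤s d<k) = p≤d .vanishes k d<k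

degreeAtMost-tail : ∀ {a p d} → DegreeAtMost (a ∷ p) (suc d) → DegreeAtMost p d
degreeAtMost-tail ap≤d .vanishes k d<k = ap≤d .vanishes (suc k) (s≤s d<k)

degreeAtMost-0 : ∀ {a p} → DegreeAtMost (a ∷ p) 0 → p ≋ []
degreeAtMost-0 ap≤0 .coeff-≡ k = ap≤0 .vanishes (suc k) (s≤s z≤n)

degreeAtMost-const : ∀ a → DegreeAtMost (const a) 0
degreeAtMost-const a .vanishes (suc k) _ = refl

degreeAtMost-cubic : ∀ {a b c d} → DegreeAtMost (d ∷ c ∷ b ∷ a ∷ []) 3
degreeAtMost-cubic .vanishes (suc (suc (suc (suc k)))) _                     = refl
degreeAtMost-cubic .vanishes (suc (suc (suc zero)))    (s≤s (s≤s (s≤s ())))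
degreeAtMost-cubic .vanishes (suc (suc zero))          (s≤s (s≤s ()))
degreeAtMost-cubic .vanishes (suc zero)                (s≤s ())

isUnit⇒degreeAtMost-0 : ∀ {p} → IsUnit p → DegreeAtMost p 0
isUnit⇒degreeAtMost-0 (u , _ , p≈u) = degreeAtMost-≋ (λ where .coeff-≡ → p≈u) (degreeAtMost-const u)

const-⊗ : ∀ a {p} q → p ≋ [] → ((a ∷ p) ⊗ q) ≋ (a · q)
const-⊗ a {p} q p≋0 =
  ≋-trans (⊕-cong ≋-refl (≋-trans (shift-cong (⊗-zeroˡ p q p≋0)) shift-[])) (⊕-identityʳ (a · q))

coeff-⊗-suc : ∀ a p q n → coeff ((a ∷ p) ⊗ q) (suc n) ≡ a * coeff q (suc n) + coeff (p ⊗ q) n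
coeff-⊗-suc a p q n =
  trans (coeff-⊕ (a · q) (shift (p ⊗ q)) (suc n)) (cong (_+ coeff (p ⊗ q) n) (coeff-· a q (suc n)))

degreeAtMost-⊗ : ∀ {p q m n} → DegreeAtMost p m → DegreeAtMost q n → DegreeAtMost (p ⊗ q) (m ℕ.+ n)
degreeAtMost-⊗ {[]}                    p≤m q≤n .vanishes k _ = refl
degreeAtMost-⊗ {a ∷ p} {q} {zero}      p≤m q≤n =
  degreeAtMost-≋ (const-⊗ a q (degreeAtMost-0 p≤m)) (degreeAtMost-· a q≤n)
degreeAtMost-⊗ {a ∷ p} {q} {suc m} {n} p≤m q≤n =
  degreeAtMost-⊕ (degreeAtMost-· a (degreeAtMost-mono (ℕP.m≤n+m n (suc m)) q≤n))
                 (degreeAtMost-shift (degreeAtMost-⊗ (degreeAtMost-tail p≤m) q≤n))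

coeff-⊗-top : ∀ {p q m n} → DegreeAtMost p m → DegreeAtMost q n →
              coeff (p ⊗ q) (m ℕ.+ n) ≡ coeff p m * coeff q n
coeff-⊗-top {[]}    {q} {n = n} p≤m q≤n = sym (ℚP.*-zeroˡ (coeff q n))
coeff-⊗-top {a ∷ p} {q} {zero}  p≤m q≤n = trans (const-⊗ a q (degreeAtMost-0 p≤m) .coeff-≡ _) (coeff-· a q _)
coeff-⊗-top {a ∷ p} {q} {suc m} {n} p≤m q≤n = begin
  coeff ((a ∷ p) ⊗ q) (suc m ℕ.+ n)                    ≡⟨ coeff-⊗-suc a p q (m ℕ.+ n) ⟩
  a * coeff q (suc m ℕ.+ n) + coeff (p ⊗ q) (m ℕ.+ n)  ≡⟨ cong₂ (λ u v → a * u + v)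
                                                            (q≤n .vanishes _ (s≤s (ℕP.m≤n+m n m)))
                                                            (coeff-⊗-top (degreeAtMost-tail p≤m) q≤n) ⟩
  a * 0ℚ + coeff p m * coeff q n                        ≡⟨ cong (_+ _) (ℚP.*-zeroʳ a) ⟩
  0ℚ + coeff p m * coeff q n                            ≡⟨ ℚP.+-identityˡ _ ⟩
  coeff p m * coeff q n                                 ∎
  where open ≡-Reasoning

*-≢0 : ∀ {x y} → x ≢ 0ℚ → y ≢ 0ℚ → x * y ≢ 0ℚ
*-≢0 {x} {y} x≢0 y≢0 xy≡0 = y≢0 (begin
  y               ≡⟨ ℚP.*-identityˡ y ⟨
  1ℚ * y          ≡⟨ cong (_* y) (ℚP.*-inverseˡ x) ⟨
  (1/ x * x) * y  ≡⟨ ℚP.*-assoc (1/ x) x y ⟩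
  1/ x * (x * y)  ≡⟨ cong (1/ x *_) xy≡0 ⟩
  1/ x * 0ℚ       ≡⟨ ℚP.*-zeroʳ (1/ x) ⟩
  0ℚ              ∎)
  where
  open ≡-Reasoning
  instance _ = ℚ.≢-nonZero x≢0

hasDegree-≋ : ∀ {p q d} → p ≋ q → HasDegree q d → HasDegree p d
hasDegree-≋ {d = d} p≋q (q≢0 , q≤d) = (λ p≡0 → q≢0 (trans (sym (p≋q .coeff-≡ d)) p≡0)) , degreeAtMost-≋ p≋q q≤d

hasDegree-unique : ∀ {p m n} → HasDegree p m → HasDegree p n → m ≡ n
hasDegree-unique {m = m} {n} (pₘ≢0 , p≤m) (pₙ≢0 , p≤n) with ℕP.<-cmp m n
... | tri< m<n _ _ = ⊥-elim (pₙ≢0 (p≤m .vanishes n m<n))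
... | tri≈ _ m≡n _ = m≡n
... | tri> _ _ n<m = ⊥-elim (pₘ≢0 (p≤n .vanishes m n<m))

≋[]⊎hasDegree : ∀ p → p ≋ [] ⊎ Σ ℕ (HasDegree p)
≋[]⊎hasDegree [] = inj₁ ≋-refl
≋[]⊎hasDegree (a ∷ p) with ≋[]⊎hasDegree p
... | inj₂ (d , (p≢0 , p≤d)) = inj₂ (suc d , (p≢0 , λ where .vanishes (suc k) (s≤s d<k) → p≤d .vanishes k d<k))
... | inj₁ p≋0 with a ℚP.≟ 0ℚ
...   | yes a≡0 = inj₁ (≋-trans (∷-cong a≡0 p≋0) shift-[])
...   | no  a≢0 = inj₂ (0 , (a≢0 , λ where .vanishes (suc k) _ → p≋0 .coeff-≡ k))

hasDegree-⊗ : ∀ {p q m n} → HasDegree p m → HasDegree q n → HasDegree (p ⊗ q) (m ℕ.+ n)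
hasDegree-⊗ (p≢0 , p≤m) (q≢0 , q≤n) =
  (λ pq≡0 → *-≢0 p≢0 q≢0 (trans (sym (coeff-⊗-top p≤m q≤n)) pq≡0)) , degreeAtMost-⊗ p≤m q≤n

hasDegree-⊕ˡ : ∀ {p q d e} → DegreeAtMost p e → e ℕ.< d → HasDegree q d → HasDegree (p ⊕ q) d
hasDegree-⊕ˡ {p} {q} {d} p≤e e<d (q≢0 , q≤d) =
  (λ pq≡0 → q≢0 (begin
     coeff q d              ≡⟨ ℚP.+-identityˡ (coeff q d) ⟨
     0ℚ + coeff q d         ≡⟨ cong (_+ coeff q d) (p≤e .vanishes d e<d) ⟨
     coeff p d + coeff q d  ≡⟨ coeff-⊕ p q d ⟨
     coeff (p ⊕ q) d        ≡⟨ pq≡0 ⟩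
     0ℚ                     ∎))
  , degreeAtMost-⊕ (degreeAtMost-mono (ℕP.<⇒≤ e<d) p≤e) q≤d
  where open ≡-Reasoning

∘ₚ-zeroˡ : ∀ {p} q → p ≋ [] → (p ∘ₚ q) ≋ []
∘ₚ-zeroˡ {[]}    q p≋0 = ≋-refl
∘ₚ-zeroˡ {a ∷ p} q p≋0 =
  ⊕-cong (≋-trans (∷-cong (p≋0 .coeff-≡ zero) (≋-refl {[]})) shift-[])
         (≋-trans (⊗-congʳ q (∘ₚ-zeroˡ q (tail-≋[] p≋0))) (⊗-zeroʳ q))

hasDegree-∘ₚ : ∀ {p q m n} → HasDegree p m → HasDegree q (suc n) → HasDegree (p ∘ₚ q) (m ℕ.* suc n)
hasDegree-∘ₚ {[]}            (p≢0 , _) q° = ⊥-elim (p≢0 refl)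
hasDegree-∘ₚ {a ∷ p} {q} {zero}  (a≢0 , p≤0) q° =
  hasDegree-≋ (≋-trans (⊕-cong ≋-refl (≋-trans (⊗-congʳ q (∘ₚ-zeroˡ q (degreeAtMost-0 p≤0))) (⊗-zeroʳ q)))
                       (⊕-identityʳ (const a)))
              (a≢0 , degreeAtMost-const a)
hasDegree-∘ₚ {a ∷ p} {q} {suc m} (p≢0 , p≤m) q° =
  hasDegree-⊕ˡ (degreeAtMost-const a) (s≤s z≤n) (hasDegree-⊗ q° (hasDegree-∘ₚ (p≢0 , degreeAtMost-tail p≤m) q°))

reducible-if-factors : ∀ {P} g h {d e} → P ≋ (g ⊗ h) → HasDegree P d → HasDegree h (suc e) → suc e ℕ.< d →
                       Reducible P
reducible-if-factors {P} g h {d} {e} P≋gh (P≢0 , _) (h≢0 , h≤e) e<d (_ , factors) with factors g h (P≋gh .coeff-≡)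
... | inj₁ g-unit = P≢0 (degreeAtMost-≋ P≋gh (degreeAtMost-⊗ (isUnit⇒degreeAtMost-0 {g} g-unit) h≤e) .vanishes d e<d)
... | inj₂ h-unit = h≢0 (isUnit⇒degreeAtMost-0 {h} h-unit .vanishes (suc e) (s≤s z≤n))

-- Roots and irreducibility

eval : Polyℚ → ℚ → ℚ
eval []      x = 0ℚ
eval (a ∷ p) x = a + x * eval p x

eval-⊕ : ∀ p q x → eval (p ⊕ q) x ≡ eval p x + eval q x
eval-⊕ []      q       x = sym (ℚP.+-identityˡ (eval q x))
eval-⊕ (a ∷ p) []      x = sym (ℚP.+-identityʳ (eval (a ∷ p) x))
eval-⊕ (a ∷ p) (b ∷ q) x = trans (cong (λ v → (a + b) + x * v) (eval-⊕ p q x))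
  (solve 5 (λ a b x P Q → (a :+ b) :+ x :* (P :+ Q) := (a :+ x :* P) :+ (b :+ x :* Q)) refl a b x (eval p x) (eval q x))
  where open ℚ-Solver

eval-· : ∀ c p x → eval (c · p) x ≡ c * eval p x
eval-· c []      x = sym (ℚP.*-zeroʳ c)
eval-· c (a ∷ p) x = trans (cong (λ v → c * a + x * v) (eval-· c p x))
  (solve 4 (λ c a x P → c :* a :+ x :* (c :* P) := c :* (a :+ x :* P)) refl c a x (eval p x))
  where open ℚ-Solver

eval-⊗ : ∀ p q x → eval (p ⊗ q) x ≡ eval p x * eval q x
eval-⊗ []      q x = sym (ℚP.*-zeroˡ (eval q x))
eval-⊗ (a ∷ p) q x = trans (eval-⊕ (a · q) (shift (p ⊗ q)) x)
  (trans (cong₂ (λ u v → u + (0ℚ + x * v)) (eval-· a q x) (eval-⊗ p q x))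
   (solve 4 (λ a x P Q → a :* Q :+ (con 0ℚ :+ x :* (P :* Q)) := (a :+ x :* P) :* Q) refl a x (eval p x) (eval q x)))
  where open ℚ-Solver

eval-≋[] : ∀ {p} x → p ≋ [] → eval p x ≡ 0ℚ
eval-≋[] {[]}    x p≋0 = refl
eval-≋[] {a ∷ p} x p≋0 = begin
  a + x * eval p x  ≡⟨ cong₂ (λ u v → u + x * v) (p≋0 .coeff-≡ zero) (eval-≋[] x (tail-≋[] p≋0)) ⟩
  0ℚ + x * 0ℚ       ≡⟨ trans (ℚP.+-identityˡ (x * 0ℚ)) (ℚP.*-zeroʳ x) ⟩
  0ℚ                ∎
  where open ≡-Reasoning

eval-≋ : ∀ {p q} x → p ≋ q → eval p x ≡ eval q x
eval-≋ {[]}    {q}     x p≋q = sym (eval-≋[] x (≋-sym p≋q))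
eval-≋ {a ∷ p} {[]}    x p≋q = eval-≋[] x p≋q
eval-≋ {a ∷ p} {b ∷ q} x p≋q = cong₂ (λ u v → u + x * v) (p≋q .coeff-≡ zero) (eval-≋ x (tail-≋ p≋q))

hasDegree-0⇒isUnit : ∀ {p} → HasDegree p 0 → IsUnit p
hasDegree-0⇒isUnit {p} (p₀≢0 , p≤0) =
  coeff p 0 , p₀≢0 , λ { zero → refl ; (suc n) → p≤0 .vanishes (suc n) (s≤s z≤n) }

hasDegree-1⇒root : ∀ {p} → HasDegree p 1 → Σ ℚ λ r → eval p r ≡ 0ℚ
hasDegree-1⇒root {p} (p₁≢0 , p≤1) = r , trans (eval-≋ r p≋linear) root
  where
  open ℚ-Solver
  instance _ = ℚ.≢-nonZero p₁≢0
  p₀ = coeff p 0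
  p₁ = coeff p 1
  r = - (p₀ * 1/ p₁)
  p≋linear : p ≋ (p₀ ∷ p₁ ∷ [])
  p≋linear .coeff-≡ zero          = refl
  p≋linear .coeff-≡ (suc zero)    = refl
  p≋linear .coeff-≡ (suc (suc n)) = p≤1 .vanishes (suc (suc n)) (s≤s (s≤s z≤n))
  root : p₀ + r * (p₁ + r * 0ℚ) ≡ 0ℚ
  root = begin
    p₀ + r * (p₁ + r * 0ℚ)    ≡⟨ solve 3 (λ u v w → u :+ (:- (u :* w)) :* (v :+ (:- (u :* w)) :* con 0ℚ)
                                                      := u :- u :* (w :* v)) refl p₀ p₁ (1/ p₁) ⟩
    p₀ ℚ.- p₀ * (1/ p₁ * p₁)  ≡⟨ cong (λ z → p₀ ℚ.- p₀ * z) (ℚP.*-inverseˡ p₁) ⟩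
    p₀ ℚ.- p₀ * 1ℚ            ≡⟨ solve 1 (λ u → u :- u :* con 1ℚ := con 0ℚ) refl p₀ ⟩
    0ℚ                        ∎
    where open ≡-Reasoning

irreducible-if-noRoot : ∀ {p} → HasDegree p 3 → (∀ r → eval p r ≢ 0ℚ) → Irreducible p
irreducible-if-noRoot {p} p°@(p₃≢0 , _) noRoot = (3 , s≤s z≤n , p₃≢0) , factors
  where
  noRoot-factorˡ : ∀ g h → p ≋ (g ⊗ h) → ∀ r → eval g r ≢ 0ℚ
  noRoot-factorˡ g h p≋gh r gr≡0 = noRoot r (begin
    eval p r             ≡⟨ eval-≋ r p≋gh ⟩
    eval (g ⊗ h) r       ≡⟨ eval-⊗ g h r ⟩
    eval g r * eval h r  ≡⟨ cong (_* eval h r) gr≡0 ⟩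
    0ℚ * eval h r        ≡⟨ ℚP.*-zeroˡ (eval h r) ⟩
    0ℚ                   ∎)
    where open ≡-Reasoning

  byDegrees : ∀ {g h} m n → m ℕ.+ n ≡ 3 → p ≋ (g ⊗ h) → HasDegree g m → HasDegree h n → IsUnit g ⊎ IsUnit h
  byDegrees 0 _ _ _ g° _ = inj₁ (hasDegree-0⇒isUnit g°)
  byDegrees 3 0 _ _ _ h° = inj₂ (hasDegree-0⇒isUnit h°)
  byDegrees {g} {h} 1 _ _ p≋gh g° _ =
    let (r , gr≡0) = hasDegree-1⇒root g° in ⊥-elim (noRoot-factorˡ g h p≋gh r gr≡0)
  byDegrees {g} {h} 2 1 _ p≋gh _ h° =
    let (r , hr≡0) = hasDegree-1⇒root h° in ⊥-elim (noRoot-factorˡ h g (≋-trans p≋gh (⊗-comm g h)) r hr≡0)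
  byDegrees 2 0 ()
  byDegrees 2 (suc (suc _)) ()
  byDegrees 3 (suc _) ()
  byDegrees (suc (suc (suc (suc _)))) _ ()

  factors : ∀ g h → p ≈ₚ (g ⊗ h) → IsUnit g ⊎ IsUnit h
  factors g h p≈gh with ≋[]⊎hasDegree g | ≋[]⊎hasDegree h
  ... | inj₁ g≋0 | _ = ⊥-elim (p₃≢0 (trans (p≈gh 3) (⊗-zeroˡ g h g≋0 .coeff-≡ 3)))
  ... | inj₂ _ | inj₁ h≋0 = ⊥-elim (p₃≢0 (trans (p≈gh 3) (≋-trans (⊗-comm g h) (⊗-zeroˡ h g h≋0) .coeff-≡ 3)))
  ... | inj₂ (m , g°) | inj₂ (n , h°) =
    byDegrees m n (hasDegree-unique (hasDegree-≋ p≋gh (hasDegree-⊗ g° h°)) p°) p≋gh g° h°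
    where
    p≋gh : p ≋ (g ⊗ h)
    p≋gh .coeff-≡ = p≈gh

-- Congruences of integers

infix 4 _≡_mod_

record _≡_mod_ (x y m : ℤ) : Set where
  constructor mod-∣
  field ∣-difference : m ∣ x ℤ.- y

mod-refl : ∀ {m} x → x ≡ x mod m
mod-refl {m} x = mod-∣ (divides (+ 0) (trans (ℤP.+-inverseʳ x) (sym (ℤP.*-zeroˡ m))))


+-cong-mod : ∀ {m x x′ y y′} → x ≡ x′ mod m → y ≡ y′ mod m → x ℤ.+ y ≡ x′ ℤ.+ y′ mod m
+-cong-mod {m} {x} {x′} {y} {y′} (mod-∣ x≡x′) (mod-∣ y≡y′) = mod-∣ (subst (m ∣_) (sym (regroup x x′ y y′)) (∣m∣n⇒∣m+n x≡x′ y≡y′))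
  where
  regroup : ∀ x x′ y y′ → (x ℤ.+ y) ℤ.- (x′ ℤ.+ y′) ≡ (x ℤ.- x′) ℤ.+ (y ℤ.- y′)
  regroup = solve-∀

*-cong-mod : ∀ {m x x′ y y′} → x ≡ x′ mod m → y ≡ y′ mod m → x ℤ.* y ≡ x′ ℤ.* y′ mod m
*-cong-mod {m} {x} {x′} {y} {y′} (mod-∣ x≡x′) (mod-∣ y≡y′) = mod-∣ (subst (m ∣_) (sym (regroup x x′ y y′)) (∣m∣n⇒∣m+n (∣n⇒∣m*n x y≡y′) (∣m⇒∣m*n y′ x≡x′)))
  where
  regroup : ∀ x x′ y y′ → x ℤ.* y ℤ.- x′ ℤ.* y′ ≡ x ℤ.* (y ℤ.- y′) ℤ.+ (x ℤ.- x′) ℤ.* y′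
  regroup = solve-∀

∣-respects-mod : ∀ {m x y} → x ≡ y mod m → m ∣ x → m ∣ y
∣-respects-mod {m} {x} {y} (mod-∣ x≡y) m∣x = subst (m ∣_) (regroup x y) (∣m∣n⇒∣m-n m∣x x≡y)
  where
  regroup : ∀ x y → x ℤ.- (x ℤ.- y) ≡ y
  regroup = solve-∀

+-multiple-mod : ∀ r q m → r ℤ.+ q ℤ.* m ≡ r mod m
+-multiple-mod r q m = mod-∣ (divides q (cancel r (q ℤ.* m)))
  where
  cancel : ∀ r y → (r ℤ.+ y) ℤ.- r ≡ y
  cancel = solve-∀

≡-mod-%ℕ : ∀ x n .{{_ : ℕ.NonZero n}} → x ≡ + (x %ℕ n) mod + n
≡-mod-%ℕ x n =
  subst (_≡ + (x %ℕ n) mod + n) (sym (a≡a%ℕn+[a/ℕn]*n x n)) (+-multiple-mod (+ (x %ℕ n)) (x /ℕ n) (+ n))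

homogenised : Coeffs4 → ℤ → ℤ → ℤ
homogenised (a , b , c , d) P Q = a ℤ.* P ℤ.* P ℤ.* P ℤ.+ b ℤ.* P ℤ.* P ℤ.* Q ℤ.+ c ℤ.* P ℤ.* Q ℤ.* Q ℤ.+ d ℤ.* Q ℤ.* Q ℤ.* Q

homogenised-cong-mod : ∀ {m a a′ b b′ c c′ d d′ P P′ Q Q′} →
  a ≡ a′ mod m → b ≡ b′ mod m → c ≡ c′ mod m → d ≡ d′ mod m → P ≡ P′ mod m → Q ≡ Q′ mod m →
  homogenised (a , b , c , d) P Q ≡ homogenised (a′ , b′ , c′ , d′) P′ Q′ mod m
homogenised-cong-mod a≡ b≡ c≡ d≡ P≡ Q≡ =
  +-cong-mod (+-cong-mod (+-cong-mod (monomial a≡ P≡ P≡ P≡) (monomial b≡ P≡ P≡ Q≡)) (monomial c≡ P≡ Q≡ Q≡)) (monomial d≡ Q≡ Q≡ Q≡)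
  where
  monomial : ∀ {m x x′ y y′ z z′ w w′} → x ≡ x′ mod m → y ≡ y′ mod m → z ≡ z′ mod m → w ≡ w′ mod m →
             x ℤ.* y ℤ.* z ℤ.* w ≡ x′ ℤ.* y′ ℤ.* z′ ℤ.* w′ mod m
  monomial x≡ y≡ z≡ w≡ = *-cong-mod (*-cong-mod (*-cong-mod x≡ y≡) z≡) w≡

form₃ : ℤ → ℤ → ℤ
form₃ = homogenised (+ 1 , + 2 , + 0 , + 1)

form₃-residues : ∀ r s → r ℕ.< 3 → s ℕ.< 3 → + 3 ∣ form₃ (+ r) (+ s) → r ≡ 0 × s ≡ 0
form₃-residues 0 0 _ _ _ = refl , refl
form₃-residues 0 1 _ _ 3∣ = ⊥-elim (from-no (+ 3 ∣? form₃ (+ 0) (+ 1)) 3∣)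
form₃-residues 0 2 _ _ 3∣ = ⊥-elim (from-no (+ 3 ∣? form₃ (+ 0) (+ 2)) 3∣)
form₃-residues 1 0 _ _ 3∣ = ⊥-elim (from-no (+ 3 ∣? form₃ (+ 1) (+ 0)) 3∣)
form₃-residues 1 1 _ _ 3∣ = ⊥-elim (from-no (+ 3 ∣? form₃ (+ 1) (+ 1)) 3∣)
form₃-residues 1 2 _ _ 3∣ = ⊥-elim (from-no (+ 3 ∣? form₃ (+ 1) (+ 2)) 3∣)
form₃-residues 2 0 _ _ 3∣ = ⊥-elim (from-no (+ 3 ∣? form₃ (+ 2) (+ 0)) 3∣)
form₃-residues 2 1 _ _ 3∣ = ⊥-elim (from-no (+ 3 ∣? form₃ (+ 2) (+ 1)) 3∣)
form₃-residues 2 2 _ _ 3∣ = ⊥-elim (from-no (+ 3 ∣? form₃ (+ 2) (+ 2)) 3∣)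
form₃-residues (suc (suc (suc _))) _ (s≤s (s≤s (s≤s ()))) _
form₃-residues _ (suc (suc (suc _))) _ (s≤s (s≤s (s≤s ())))

%ℕ≡0⇒∣ : ∀ x n .{{_ : ℕ.NonZero n}} → x %ℕ n ≡ 0 → + n ∣ x
%ℕ≡0⇒∣ x n x%n≡0 with ≡-mod-%ℕ x n
... | mod-∣ n∣x-r rewrite x%n≡0 = subst (+ n ∣_) (ℤP.+-identityʳ x) n∣x-r

form₃≡0-mod3 : ∀ P Q → + 3 ∣ form₃ P Q → + 3 ∣ P × + 3 ∣ Q
form₃≡0-mod3 P Q 3∣PQ = %ℕ≡0⇒∣ P 3 (proj₁ residues≡0) , %ℕ≡0⇒∣ Q 3 (proj₂ residues≡0)
  where
  P≡ : P ≡ + (P %ℕ 3) mod + 3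
  P≡ = ≡-mod-%ℕ P 3
  Q≡ : Q ≡ + (Q %ℕ 3) mod + 3
  Q≡ = ≡-mod-%ℕ Q 3
  form≡ : form₃ P Q ≡ form₃ (+ (P %ℕ 3)) (+ (Q %ℕ 3)) mod + 3
  form≡ = homogenised-cong-mod (mod-refl (+ 1)) (mod-refl (+ 2)) (mod-refl (+ 0)) (mod-refl (+ 1)) P≡ Q≡
  residues≡0 = form₃-residues (P %ℕ 3) (Q %ℕ 3) (n%ℕd<d P 3) (n%ℕd<d Q 3) (∣-respects-mod form≡ 3∣PQ)

-- Rational roots of integer cubics

toℚᵘ-ℤ→ℚ : ∀ z → toℚᵘ (ℤ→ℚ z) ≃ᵘ mkℚᵘ z 0
toℚᵘ-ℤ→ℚ z = ℚP.toℚᵘ-fromℚᵘ (mkℚᵘ z 0)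

ℤ→ℚ-+ : ∀ x y → ℤ→ℚ (x ℤ.+ y) ≡ ℤ→ℚ x + ℤ→ℚ y
ℤ→ℚ-+ x y = ℚP.toℚᵘ-injective (begin
  toℚᵘ (ℤ→ℚ (x ℤ.+ y))                 ≈⟨ toℚᵘ-ℤ→ℚ (x ℤ.+ y) ⟩
  mkℚᵘ (x ℤ.+ y) 0                      ≈⟨ *≡* (regroup x y) ⟩
  mkℚᵘ x 0 ℚᵘ.+ mkℚᵘ y 0               ≈⟨ ℚᵘP.+-cong (toℚᵘ-ℤ→ℚ x) (toℚᵘ-ℤ→ℚ y) ⟨
  toℚᵘ (ℤ→ℚ x) ℚᵘ.+ toℚᵘ (ℤ→ℚ y)       ≈⟨ ℚP.toℚᵘ-homo-+ (ℤ→ℚ x) (ℤ→ℚ y) ⟨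
  toℚᵘ (ℤ→ℚ x + ℤ→ℚ y)                 ∎)
  where
  open SetoidReasoning ℚᵘP.≃-setoid
  regroup : ∀ x y → (x ℤ.+ y) ℤ.* + 1 ≡ (x ℤ.* + 1 ℤ.+ y ℤ.* + 1) ℤ.* + 1
  regroup = solve-∀

ℤ→ℚ-* : ∀ x y → ℤ→ℚ (x ℤ.* y) ≡ ℤ→ℚ x * ℤ→ℚ y
ℤ→ℚ-* x y = ℚP.toℚᵘ-injective (begin
  toℚᵘ (ℤ→ℚ (x ℤ.* y))                 ≈⟨ toℚᵘ-ℤ→ℚ (x ℤ.* y) ⟩
  mkℚᵘ (x ℤ.* y) 0                      ≈⟨ ℚᵘP.*-cong (toℚᵘ-ℤ→ℚ x) (toℚᵘ-ℤ→ℚ y) ⟨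
  toℚᵘ (ℤ→ℚ x) ℚᵘ.* toℚᵘ (ℤ→ℚ y)       ≈⟨ ℚP.toℚᵘ-homo-* (ℤ→ℚ x) (ℤ→ℚ y) ⟨
  toℚᵘ (ℤ→ℚ x * ℤ→ℚ y)                 ∎)
  where open SetoidReasoning ℚᵘP.≃-setoid

ℤ→ℚ-injective : ∀ {x y} → ℤ→ℚ x ≡ ℤ→ℚ y → x ≡ y
ℤ→ℚ-injective {x} {y} eq with ℚᵘP.≃-trans (ℚᵘP.≃-sym (toℚᵘ-ℤ→ℚ x)) (ℚᵘP.≃-trans (ℚᵘP.≃-reflexive (cong toℚᵘ eq)) (toℚᵘ-ℤ→ℚ y))
... | *≡* x*1≡y*1 = trans (sym (ℤP.*-identityʳ x)) (trans x*1≡y*1 (ℤP.*-identityʳ y))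

↧*≡↥ : ∀ r → ℤ→ℚ (ℚ.↧ r) * r ≡ ℤ→ℚ (ℚ.↥ r)
↧*≡↥ r@(mkℚ P d-1 _) = ℚP.toℚᵘ-injective (begin
  toℚᵘ (ℤ→ℚ (+ suc d-1) * r)              ≈⟨ ℚP.toℚᵘ-homo-* (ℤ→ℚ (+ suc d-1)) r ⟩
  toℚᵘ (ℤ→ℚ (+ suc d-1)) ℚᵘ.* mkℚᵘ P d-1  ≈⟨ ℚᵘP.*-congʳ (toℚᵘ-ℤ→ℚ (+ suc d-1)) ⟩
  mkℚᵘ (+ suc d-1) 0 ℚᵘ.* mkℚᵘ P d-1      ≈⟨ *≡* (trans (cancel (+ suc d-1) P) (cong (λ n → P ℤ.* + suc n) (sym (ℕP.+-identityʳ d-1)))) ⟩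
  mkℚᵘ P 0                                 ≈⟨ toℚᵘ-ℤ→ℚ P ⟨
  toℚᵘ (ℤ→ℚ P)                             ∎)
  where
  open SetoidReasoning ℚᵘP.≃-setoid
  cancel : ∀ Q P → Q ℤ.* P ℤ.* + 1 ≡ P ℤ.* Q
  cancel = solve-∀

ℤ→ℚ-homogenised : ∀ (t : Coeffs4) P Q → let (a , b , c , d) = t in
  ℤ→ℚ (homogenised t P Q) ≡ ℤ→ℚ a * ℤ→ℚ P * ℤ→ℚ P * ℤ→ℚ P + ℤ→ℚ b * ℤ→ℚ P * ℤ→ℚ P * ℤ→ℚ Q
                            + ℤ→ℚ c * ℤ→ℚ P * ℤ→ℚ Q * ℤ→ℚ Q + ℤ→ℚ d * ℤ→ℚ Q * ℤ→ℚ Q * ℤ→ℚ Q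
ℤ→ℚ-homogenised (a , b , c , d) P Q =
  trans (ℤ→ℚ-+ (m₁ ℤ.+ m₂ ℤ.+ m₃) m₄) (cong₂ _+_
    (trans (ℤ→ℚ-+ (m₁ ℤ.+ m₂) m₃) (cong₂ _+_
      (trans (ℤ→ℚ-+ m₁ m₂) (cong₂ _+_ (ℤ→ℚ-monomial a P P P) (ℤ→ℚ-monomial b P P Q)))
      (ℤ→ℚ-monomial c P Q Q)))
    (ℤ→ℚ-monomial d Q Q Q))
  where
  m₁ = a ℤ.* P ℤ.* P ℤ.* P
  m₂ = b ℤ.* P ℤ.* P ℤ.* Q
  m₃ = c ℤ.* P ℤ.* Q ℤ.* Q
  m₄ = d ℤ.* Q ℤ.* Q ℤ.* Q
  ℤ→ℚ-monomial : ∀ x y z w → ℤ→ℚ (x ℤ.* y ℤ.* z ℤ.* w) ≡ ℤ→ℚ x * ℤ→ℚ y * ℤ→ℚ z * ℤ→ℚ w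
  ℤ→ℚ-monomial x y z w =
    trans (ℤ→ℚ-* (x ℤ.* y ℤ.* z) w)
          (cong (_* ℤ→ℚ w) (trans (ℤ→ℚ-* (x ℤ.* y) z) (cong (_* ℤ→ℚ z) (ℤ→ℚ-* x y))))

homogenised-eval : ∀ (t : Coeffs4) r → let Q = ℤ→ℚ (ℚ.↧ r) in
  ℤ→ℚ (homogenised t (ℚ.↥ r) (ℚ.↧ r)) ≡ Q * Q * Q * eval (cubic t) r
homogenised-eval t@(a , b , c , d) r = begin
  ℤ→ℚ (homogenised t (ℚ.↥ r) (ℚ.↧ r))
    ≡⟨ ℤ→ℚ-homogenised t (ℚ.↥ r) (ℚ.↧ r) ⟩
  A * P * P * P + B * P * P * Q + C * P * Q * Q + D * Q * Q * Q
    ≡⟨ cong (λ P → A * P * P * P + B * P * P * Q + C * P * Q * Q + D * Q * Q * Q) (↧*≡↥ r) ⟨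
  A * (Q * r) * (Q * r) * (Q * r) + B * (Q * r) * (Q * r) * Q + C * (Q * r) * Q * Q + D * Q * Q * Q
    ≡⟨ solve 6 (λ A B C D Q r →
         A :* (Q :* r) :* (Q :* r) :* (Q :* r) :+ B :* (Q :* r) :* (Q :* r) :* Q :+ C :* (Q :* r) :* Q :* Q :+ D :* Q :* Q :* Q
           := Q :* Q :* Q :* (D :+ r :* (C :+ r :* (B :+ r :* (A :+ r :* con 0ℚ))))) refl A B C D Q r ⟩
  Q * Q * Q * eval (cubic t) r
    ∎
  where
  open ≡-Reasoning
  open ℚ-Solver
  A = ℤ→ℚ a
  B = ℤ→ℚ b
  C = ℤ→ℚ c
  D = ℤ→ℚ d
  P = ℤ→ℚ (ℚ.↥ r)
  Q = ℤ→ℚ (ℚ.↧ r)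

cubic-noRoot-mod3 : ∀ {a b c d} → a ≡ + 1 mod + 3 → b ≡ + 2 mod + 3 → c ≡ + 0 mod + 3 → d ≡ + 1 mod + 3 →
                    ∀ r → eval (cubic (a , b , c , d)) r ≢ 0ℚ
cubic-noRoot-mod3 {a} {b} {c} {d} a≡ b≡ c≡ d≡ r@(mkℚ P d-1 coprime) root = 3≢1 (recompute coprime (∣⇒∣ᵤ 3∣P , ∣⇒∣ᵤ 3∣Q))
  where
  Q = ℚ.↧ r
  homogenised≡0 : homogenised (a , b , c , d) P Q ≡ + 0
  homogenised≡0 = ℤ→ℚ-injective (begin
    ℤ→ℚ (homogenised (a , b , c , d) P Q)            ≡⟨ homogenised-eval (a , b , c , d) r ⟩
    ℤ→ℚ Q * ℤ→ℚ Q * ℤ→ℚ Q * eval (cubic (a , b , c , d)) r ≡⟨ cong (ℤ→ℚ Q * ℤ→ℚ Q * ℤ→ℚ Q *_) root ⟩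
    ℤ→ℚ Q * ℤ→ℚ Q * ℤ→ℚ Q * 0ℚ                      ≡⟨ ℚP.*-zeroʳ (ℤ→ℚ Q * ℤ→ℚ Q * ℤ→ℚ Q) ⟩
    0ℚ                                                ∎)
    where open ≡-Reasoning
  3∣form₃ : + 3 ∣ form₃ P Q
  3∣form₃ = ∣-respects-mod (homogenised-cong-mod a≡ b≡ c≡ d≡ (mod-refl P) (mod-refl Q))
                           (divides (+ 0) homogenised≡0)
  3∣P = form₃≡0-mod3 P Q 3∣form₃ .proj₁
  3∣Q = form₃≡0-mod3 P Q 3∣form₃ .proj₂
  3≢1 : 3 ≢ 1
  3≢1 ()

-- The family

T : ℕ → Coeffs4
T k = + (214 ℕ.+ 648 ℕ.* k) , + (107 ℕ.+ 324 ℕ.* k) , + (18 ℕ.+ 54 ℕ.* k) , + (1 ℕ.+ 3 ℕ.* k)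

≡-mod3 : ∀ r m n k → + (r ℕ.+ 3 ℕ.* m ℕ.+ 3 ℕ.* n ℕ.* k) ≡ + r mod + 3
≡-mod3 r m n k = subst (_≡ + r mod + 3) (sym (begin
  + (r ℕ.+ 3 ℕ.* m ℕ.+ 3 ℕ.* n ℕ.* k)  ≡⟨ cong +_ (regroup r m n k) ⟩
  + (r ℕ.+ q ℕ.* 3)                    ≡⟨ ℤP.pos-+ r (q ℕ.* 3) ⟩
  + r ℤ.+ + (q ℕ.* 3)                  ≡⟨ cong (ℤ._+_ (+ r)) (ℤP.pos-* q 3) ⟩
  + r ℤ.+ + q ℤ.* + 3                  ∎))
  (+-multiple-mod (+ r) (+ q) (+ 3))
  where
  open ≡-Reasoning
  q = m ℕ.+ n ℕ.* k
  regroup : ∀ r m n k → r ℕ.+ 3 ℕ.* m ℕ.+ 3 ℕ.* n ℕ.* k ≡ r ℕ.+ (m ℕ.+ n ℕ.* k) ℕ.* 3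
  regroup = ℕ-solve-∀

ℤ→ℚ-suc≢0 : ∀ n → ℤ→ℚ (+ suc n) ≢ 0ℚ
ℤ→ℚ-suc≢0 n eq with ℤ→ℚ-injective {+ suc n} {+ 0} eq
... | ()

T-hasDegree : ∀ k → HasDegree (cubic (T k)) 3
T-hasDegree k = ℤ→ℚ-suc≢0 (213 ℕ.+ 648 ℕ.* k) , degreeAtMost-cubic

T-irreducible : ∀ k → Irreducible (cubic (T k))
T-irreducible k = irreducible-if-noRoot (T-hasDegree k)
  (cubic-noRoot-mod3 (≡-mod3 1 71 216 k) (≡-mod3 2 35 108 k) (≡-mod3 0 6 18 k) (≡-mod3 1 0 1 k))

ℤ→ℚ-affine : ∀ m n k → ℤ→ℚ (+ (m ℕ.+ n ℕ.* k)) ≡ ℤ→ℚ (+ m) + ℤ→ℚ (+ n) * ℤ→ℚ (+ k)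
ℤ→ℚ-affine m n k = begin
  ℤ→ℚ (+ (m ℕ.+ n ℕ.* k))             ≡⟨ cong ℤ→ℚ (trans (ℤP.pos-+ m (n ℕ.* k)) (cong (ℤ._+_ (+ m)) (ℤP.pos-* n k))) ⟩
  ℤ→ℚ (+ m ℤ.+ + n ℤ.* + k)          ≡⟨ trans (ℤ→ℚ-+ (+ m) (+ n ℤ.* + k)) (cong (_+_ (ℤ→ℚ (+ m))) (ℤ→ℚ-* (+ n) (+ k))) ⟩
  ℤ→ℚ (+ m) + ℤ→ℚ (+ n) * ℤ→ℚ (+ k) ∎
  where open ≡-Reasoning

module SecondIterate (k : ℕ) where

  a b c d : ℚ
  a = ℤ→ℚ (+ (214 ℕ.+ 648 ℕ.* k))
  b = ℤ→ℚ (+ (107 ℕ.+ 324 ℕ.* k))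
  c = ℤ→ℚ (+ (18 ℕ.+ 54 ℕ.* k))
  d = ℤ→ℚ (+ (1 ℕ.+ 3 ℕ.* k))

  -¼ -½ -⅛ : ℚ
  -¼ = -[1+ 0 ] ℚ./ 4
  -½ = -[1+ 0 ] ℚ./ 2
  -⅛ = -[1+ 0 ] ℚ./ 8

  f g : Polyℚ
  f = cubic (T k)
  g = const -¼ ⊕ (const -½ ⊗ X)

  n̂ : ℕ → Polyℚ
  n̂ m = const (ℤ→ℚ (+ m))

  A B C D : Polyℚ
  A = n̂ 214 ⊕ (n̂ 648 ⊗ n̂ k)
  B = n̂ 107 ⊕ (n̂ 324 ⊗ n̂ k)
  C = n̂ 18  ⊕ (n̂ 54  ⊗ n̂ k)
  D = n̂ 1   ⊕ (n̂ 3   ⊗ n̂ k)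

  f∘ₚ≋ : ∀ r → (f ∘ₚ r) ≋ horner₃ A B C D r
  f∘ₚ≋ r = ≋-trans (∘ₚ-cubic a b c d r)
    (horner₃-cong r (const-affine 214 648) (const-affine 107 324) (const-affine 18 54) (const-affine 1 3))
    where
    const-affine : ∀ m n → const (ℤ→ℚ (+ (m ℕ.+ n ℕ.* k))) ≋ (n̂ m ⊕ (n̂ n ⊗ n̂ k))
    const-affine m n = ∷-cong (trans (ℤ→ℚ-affine m n k) (cong (_+_ (ℤ→ℚ (+ m))) (sym (ℚP.+-identityʳ _)))) ≋-refl

  f≋ : f ≋ horner₃ A B C D X
  f≋ = ≋-trans (≋-sym (∘ₚ-X f)) (f∘ₚ≋ X)

  f∘g : (f ∘ₚ g) ≋ (const -⅛ ⊗ (f ⊖ g))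
  f∘g = begin
    f ∘ₚ g                                 ≈⟨ f∘ₚ≋ g ⟩
    horner₃ A B C D g                      ≈⟨ identity X (n̂ k) ⟩
    const -⅛ ⊗ (horner₃ A B C D X ⊖ g)     ≈⟨ ⊗-cong (≋-refl {const -⅛}) (⊕-cong (≋-sym f≋) (≋-refl {⊝ g})) ⟩
    const -⅛ ⊗ (f ⊖ g)                     ∎
    where
    open ≋-Reasoning
    open ℚ[x]-Solver
    identity = solve 2 (λ x κ →
      let N : ℕ → Polynomial 2
          N m = con (ℤ→ℚ (+ m))
          A = N 214 :+ N 648 :* κ
          B = N 107 :+ N 324 :* κ
          C = N 18 :+ N 54 :* κ
          D = N 1 :+ N 3 :* κ
          g = con -¼ :+ con -½ :* x
          horner₃ : Polynomial 2 → Polynomial 2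
          horner₃ r = D :+ r :* (C :+ r :* (B :+ r :* A))
      in horner₃ g := con -⅛ :* (horner₃ x :- g)) ≋-refl

  f∘f-hasDegree : HasDegree (f ∘ₚ f) 9
  f∘f-hasDegree = hasDegree-∘ₚ {n = 2} (T-hasDegree k) (T-hasDegree k)

  f⊖g-hasDegree : HasDegree (f ⊖ g) 3
  f⊖g-hasDegree = ℤ→ℚ-suc≢0 (213 ℕ.+ 648 ℕ.* k) , degreeAtMost-cubic

  reducible : Reducible (f ∘ₚ f)
  reducible = reducible-if-factors (differenceQuotient (const a) (const b) (const c) f g ⊕ const -⅛) (f ⊖ g)
    (∘ₚ-self-factorisation a b c d g -⅛ f∘g) f∘f-hasDegree f⊖g-hasDegree (s≤s (s≤s (s≤s (s≤s z≤n))))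

leadingBound : List Coeffs4 → ℕ
leadingBound []      = 0
leadingBound (t ∷ S) = ℤ.∣ leading t ∣ ℕ.+ leadingBound S

∈⇒leading≤leadingBound : ∀ {t S} → t ∈ S → ℤ.∣ leading t ∣ ℕ.≤ leadingBound S
∈⇒leading≤leadingBound {S = s ∷ S} (here refl)  = ℕP.m≤m+n _ (leadingBound S)
∈⇒leading≤leadingBound {S = s ∷ S} (there t∈S) =
  ℕP.≤-trans (∈⇒leading≤leadingBound t∈S) (ℕP.m≤n+m _ ℤ.∣ leading s ∣)

T-fresh : ∀ S → T (leadingBound S) ∉ S
T-fresh S T∈S = ℕP.<⇒≱ k<leading (∈⇒leading≤leadingBound T∈S)
  where
  k = leadingBound S
  k<leading : k ℕ.< 214 ℕ.+ 648 ℕ.* k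
  k<leading = s≤s (ℕP.≤-trans (ℕP.m≤n*m k 648) (ℕP.m≤n+m (648 ℕ.* k) 213))

theorem1p1 : (S : List Coeffs4) →
    Σ Coeffs4 λ t → (t ∉ S) × (leading t ≢ 0ℤ) ×
    Irreducible (cubic t) × Reducible (cubic t ∘ₚ cubic t)
theorem1p1 S = T k , T-fresh S , (λ ()) , T-irreducible k , SecondIterate.reducible k
  where k = leadingBound S
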